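{- Let $G$ be a finite simple graph, let $T$ be a clique in $G$, and let $z$ be a vertex of $T$ with $\deg(z)=|T|-1\ge 1$. Suppose that $z$ is the only vertex of $T$ of degree $|T|-1$ and that $\overline{T}=V(G)\setminus T$ is a clique. Then $z$ is an uncritical vertex.
   Context: Zero forcing rule: a filled vertex $v$ forces an unfilled vertex $u$ if $u$ is the only unfilled neighbor of $v$; each vertex forces at most once. A zero forcing set is an initially filled set from which repeated forcing fills all vertices; $Z(G)$ is the minimum size of a zero forcing set, and a zero forcing set of that size is optimal. An optimal forcing sequence is a sequence of valid forces from an optimal zero forcing set after which no further forces are possible. A forcing sequence yields forcing chains: maximal sequences $(v_0,\dots,v_\ell)$ with each $v_{i-1}\to v_i$ a force of the sequence; for $\ell\ge1$, $v_0$ is the source and $v_\ell$ the terminal vertex (chains of length $0$ have neither). A vertex is uncritical if for every optimal forcing sequence it is the source or the terminal vertex of the chain containing it. -}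

module Defs where

open import Data.Nat using (ℕ; _≤_)
open import Data.Bool using (Bool; true; false)
open import Data.Fin using (Fin)
open import Data.Fin.Subset using (Subset; _∈_; _∉_; _∪_; ⁅_⁆; ∣_∣)
open import Data.Vec using (tabulate)
open import Data.List using (List; []; _∷_; map; foldl; length)
open import Data.List.Relation.Unary.Linked using (Linked)
open import Data.List.Relation.Unary.Unique.Propositional using (Unique)
open import Data.List.Membership.Propositional using () renaming (_∈_ to _∈ˡ_; _∉_ to _∉ˡ_)
open import Data.Sum using (_⊎_)
open import Data.Product using (_×_; _,_; proj₁; proj₂; ∃)
open import Relation.Binary.PropositionalEquality using (_≡_; _≢_)
open import Relation.Nullary using (¬_)

record SimpleGraph (n : ℕ) : Set where
  field
    adj    : Fin n → Fin n → Bool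
    sym    : ∀ u v → adj u v ≡ adj v u
    irrefl : ∀ v → adj v v ≡ false
open SimpleGraph public

module _ {n : ℕ} (G : SimpleGraph n) where

  nbhd : Fin n → Subset n
  nbhd v = tabulate (adj G v)

  deg : Fin n → ℕ
  deg v = ∣ nbhd v ∣

  IsClique : Subset n → Set
  IsClique T = ∀ u v → u ∈ T → v ∈ T → u ≢ v → adj G u v ≡ true

  -- A force v → u is a pair (v , u)
  Force : Set
  Force = Fin n × Fin n

  CanForce : Subset n → Fin n → Fin n → Set
  CanForce S v u =
    v ∈ S × u ∉ S × adj G v u ≡ true ×
    (∀ w → adj G v w ≡ true → w ∉ S → w ≡ u)

  after : Subset n → List Force → Subset n
  after S F = foldl (λ X f → X ∪ ⁅ proj₂ f ⁆) S F

  data ValidForces : Subset n → List Force → Set where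
    []  : ∀ {S} → ValidForces S []
    _∷_ : ∀ {S v u F} → CanForce S v u → ValidForces (S ∪ ⁅ u ⁆) F →
          ValidForces S ((v , u) ∷ F)

  forcers : List Force → List (Fin n)
  forcers F = map proj₁ F

  IsForcingSequence : Subset n → List Force → Set
  IsForcingSequence S F = ValidForces S F × Unique (forcers F)

  IsMaximal : Subset n → List Force → Set
  IsMaximal S F = ∀ v u → v ∉ˡ forcers F → ¬ CanForce (after S F) v u

  IsZeroForcingSet : Subset n → Set
  IsZeroForcingSet S = ∃ λ F → IsForcingSequence S F × (∀ x → x ∈ after S F)

  IsOptimalZFS : Subset n → Set
  IsOptimalZFS S = IsZeroForcingSet S × (∀ S' → IsZeroForcingSet S' → ∣ S ∣ ≤ ∣ S' ∣)

  IsOptimalForcingSequence : Subset n → List Force → Set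
  IsOptimalForcingSequence S F = IsOptimalZFS S × IsForcingSequence S F × IsMaximal S F

  lastOf : Fin n → List (Fin n) → Fin n
  lastOf v []       = v
  lastOf v (w ∷ ws) = lastOf w ws

  -- A forcing chain of F: a maximal sequence (v₀ , vs) with consecutive
  -- vertices related by forces of F; its length is length vs.
  IsForcingChain : List Force → Fin n → List (Fin n) → Set
  IsForcingChain F v₀ vs =
    Linked (λ a b → (a , b) ∈ˡ F) (v₀ ∷ vs) ×
    (∀ w → (w , v₀) ∉ˡ F) ×
    (∀ w → (lastOf v₀ vs , w) ∉ˡ F)

  IsUncritical : Fin n → Set
  IsUncritical z =
    ∀ S F → IsOptimalForcingSequence S F →
    ∀ v₀ vs → IsForcingChain F v₀ vs → z ∈ˡ (v₀ ∷ vs) →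
    1 ≤ length vs × (z ≡ v₀ ⊎ z ≡ lastOf v₀ vs)

{-# OPTIONS --safe #-}
-- Since deg z = ∣T∣ - 1, the neighbourhood of z is exactly T ∖ z, a clique; since z is the only
-- such vertex of T, every other vertex of T has a neighbour outside T (an exit).
--
-- If z were interior to a chain p → z → q, then p and q would be adjacent neighbours of z, so q
-- was already filled when p forced z.  If z forms a chain of length 0, then z ∈ S never forces,
-- so S forces everything even when z may not force, and S is not optimal.  When T ⊆ S, drop a
-- vertex of T ∖ z (z forces it back); otherwise look at the first force v → u from S.  If v ∉ T,
-- drop z: a stalled set containing S - z contains V ∖ T (v has no unfilled neighbour left and
-- V ∖ T is a clique) and misses at most one vertex of T ∖ z, and such a set is all of V.
-- If v ∈ T ∖ z, drop an exit b of v: z forces u back, and then v forces b.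
module Submission where

open import Defs hiding (sym)
open import Data.Nat using (ℕ; zero; suc; _≤_; _<_; _∸_; _+_; s≤s; z≤n)
open import Data.Nat.Properties
  using (≤-refl; ≤-trans; ≤-antisym; n≤1+n; <⇒≱; <-irrefl; m∸n≤m; m≤n+m; m∸n+n≡m;
         +-comm; +-suc; +-identityʳ; +-monoˡ-≤)
open import Data.Bool using (true)
import Data.Bool.Properties as Bool
open import Data.Fin using (Fin)
open import Data.Fin.Properties using (_≟_; any?; all?)
open import Data.Fin.Subset using (Subset; _∈_; _∉_; ∁; ∣_∣; _∪_; ⁅_⁆; _⊆_; _-_; inside; outside)
open import Data.Fin.Subset.Properties
  using (_∈?_; x∈p∪q⁺; x∈p∪q⁻; x∈⁅x⁆; x∈⁅y⁆⇒x≡y; x∉p⇒x∈∁p; x∈p∧x≢y⇒x∈p-y; x∈p⇒∣p-x∣<∣p∣;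
         p⊂q⇒∣p∣<∣q∣; p⊆q⇒∣p∣≤∣q∣; ∣⊤∣≡n; ∣⊥∣≡0; ∈⊤; ∪-identityʳ; nonempty?; Empty-unique)
open import Data.List using ([]; _∷_)
open import Data.List.Relation.Unary.Any using (here; there; tail)
import Data.List.Relation.Unary.All as All
open import Data.List.Relation.Unary.Linked using (Linked; _∷_)
open import Data.List.Relation.Unary.AllPairs using ([]; _∷_)
open import Data.List.Relation.Unary.Unique.Propositional using (Unique)
open import Data.List.Membership.Propositional using () renaming (_∈_ to _∈ˡ_; _∉_ to _∉ˡ_)
open import Data.List.Membership.Propositional.Properties using (∈-map⁻)
import Data.List.Membership.DecPropositional as DecMembership
open import Data.Product using (_×_; _,_; proj₁; proj₂; ∃; ∃₂)
open import Data.Sum using (_⊎_; inj₁; inj₂; [_,_])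
open import Data.Vec using (_∷_; tabulate)
open import Data.Vec.Properties using (lookup∘tabulate; []=⇒lookup; lookup⇒[]=)
open import Function using (_∘_)
open import Relation.Binary.PropositionalEquality using (_≡_; _≢_; refl; sym; trans; cong; subst; ≢-sym)
open import Relation.Nullary using (¬_; Dec; yes; no; contradiction)
open import Relation.Nullary.Decidable using (_×-dec_; _→-dec_; ¬?)
open import Data.Empty using (⊥; ⊥-elim)

private
  variable
    n : ℕ
    p q : Subset n
    x y : Fin n

x∈p⇒x∈p∪⁅y⁆ : x ∈ p → x ∈ p ∪ ⁅ y ⁆
x∈p⇒x∈p∪⁅y⁆ x∈p = x∈p∪q⁺ (inj₁ x∈p)

y∈p∪⁅y⁆ : y ∈ p ∪ ⁅ y ⁆
y∈p∪⁅y⁆ {y = y} = x∈p∪q⁺ (inj₂ (x∈⁅x⁆ y))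

x∈p∪⁅y⁆⁻ : x ∈ p ∪ ⁅ y ⁆ → x ∈ p ⊎ x ≡ y
x∈p∪⁅y⁆⁻ {p = p} {y = y} x∈ with x∈p∪q⁻ p ⁅ y ⁆ x∈
... | inj₁ x∈p = inj₁ x∈p
... | inj₂ x∈y = inj₂ (x∈⁅y⁆⇒x≡y y x∈y)

p⊆q∧x∈q⇒p∪⁅x⁆⊆q : p ⊆ q → x ∈ q → p ∪ ⁅ x ⁆ ⊆ q
p⊆q∧x∈q⇒p∪⁅x⁆⊆q p⊆q x∈q y∈ with x∈p∪⁅y⁆⁻ y∈
... | inj₁ y∈p = p⊆q y∈p
... | inj₂ refl = x∈q

p-x⊆q∧x∈q⇒p⊆q : p - x ⊆ q → x ∈ q → p ⊆ q
p-x⊆q∧x∈q⇒p⊆q {x = x} p-x⊆q x∈q {y} y∈p with y ≟ x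
... | yes refl = x∈q
... | no y≢x = p-x⊆q (x∈p∧x≢y⇒x∈p-y y∈p y≢x)

p-x⊆q⇒p⊆q∪⁅x⁆ : p - x ⊆ q → p ⊆ q ∪ ⁅ x ⁆
p-x⊆q⇒p⊆q∪⁅x⁆ p-x⊆q = p-x⊆q∧x∈q⇒p⊆q (x∈p⇒x∈p∪⁅y⁆ ∘ p-x⊆q) y∈p∪⁅y⁆

∣p∪⁅x⁆∣≤1+∣p∣ : ∀ (p : Subset n) (x : Fin n) → ∣ p ∪ ⁅ x ⁆ ∣ ≤ suc ∣ p ∣
∣p∪⁅x⁆∣≤1+∣p∣ (inside  ∷ p) Fin.zero    rewrite ∪-identityʳ p = n≤1+n _
∣p∪⁅x⁆∣≤1+∣p∣ (outside ∷ p) Fin.zero    rewrite ∪-identityʳ p = ≤-refl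
∣p∪⁅x⁆∣≤1+∣p∣ (inside  ∷ p) (Fin.suc x) = s≤s (∣p∪⁅x⁆∣≤1+∣p∣ p x)
∣p∪⁅x⁆∣≤1+∣p∣ (outside ∷ p) (Fin.suc x) = ∣p∪⁅x⁆∣≤1+∣p∣ p x

∣p∣<∣p∪⁅x⁆∣ : x ∉ p → ∣ p ∣ < ∣ p ∪ ⁅ x ⁆ ∣
∣p∣<∣p∪⁅x⁆∣ x∉p = p⊂q⇒∣p∣<∣q∣ (x∈p⇒x∈p∪⁅y⁆ , _ , y∈p∪⁅y⁆ , x∉p)

x∉p⇒∣p∣<n : ∀ {n} {p : Subset n} {x} → x ∉ p → ∣ p ∣ < n
x∉p⇒∣p∣<n {n} {p} x∉p = subst (∣ p ∣ <_) (∣⊤∣≡n n) (p⊂q⇒∣p∣<∣q∣ ((λ _ → ∈⊤) , _ , ∈⊤ , x∉p))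

module Forcing {n : ℕ} (G : SimpleGraph n) where

  open DecMembership (_≟_ {n}) using () renaming (_∈?_ to _∈ˡ?_)

  E : Fin n → Fin n → Set
  E v w = adj G v w ≡ true

  E-sym : ∀ {v w} → E v w → E w v
  E-sym {v} {w} e = trans (SimpleGraph.sym G w v) e

  E⇒≢ : ∀ {v w} → E v w → v ≢ w
  E⇒≢ {v} e refl with trans (sym e) (irrefl G v)
  ... | ()

  Stalled : Subset n → Set
  Stalled Y = ∀ v u → ¬ CanForce G Y v u

  StalledExcept : Fin n → Subset n → Set
  StalledExcept z Y = ∀ v u → v ≢ z → ¬ CanForce G Y v u

  Spans : Subset n → Set
  Spans S = ∀ Y → S ⊆ Y → Stalled Y → ∀ x → x ∈ Y

  SpansWithout : Fin n → Subset n → Set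
  SpansWithout z S = ∀ Y → S ⊆ Y → StalledExcept z Y → ∀ x → x ∈ Y

  CanForce? : ∀ Y v u → Dec (CanForce G Y v u)
  CanForce? Y v u =
    (v ∈? Y) ×-dec ¬? (u ∈? Y) ×-dec (adj G v u Bool.≟ true) ×-dec
    all? (λ w → (adj G v w Bool.≟ true) →-dec ¬? (w ∈? Y) →-dec (w ≟ u))

  force-or-stalledExcept : ∀ z Y → (∃₂ λ v u → v ≢ z × CanForce G Y v u) ⊎ StalledExcept z Y
  force-or-stalledExcept z Y with any? (λ v → any? (λ u → ¬? (v ≟ z) ×-dec CanForce? Y v u))
  ... | yes (v , u , force) = inj₁ (v , u , force)
  ... | no ¬force = inj₂ (λ v u v≢z can → ¬force (v , u , v≢z , can))

  ¬CanForce⇒target∈ : ∀ {Y v u} → ¬ CanForce G Y v u → v ∈ Y → E v u →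
                      (u ∉ Y → ∀ w → E v w → w ∉ Y → w ≡ u) → u ∈ Y
  ¬CanForce⇒target∈ {Y} {u = u} ¬can v∈Y e only with u ∈? Y
  ... | yes u∈Y = u∈Y
  ... | no u∉Y = contradiction (v∈Y , u∉Y , e , only u∉Y) ¬can

  ¬CanForce⇒nbhd⊆ : ∀ {Y v u} → ¬ CanForce G Y v u → v ∈ Y →
                    (∀ w → E v w → w ∉ Y → w ≡ u) → ∀ {w} → E v w → w ∈ Y
  ¬CanForce⇒nbhd⊆ {Y} ¬can v∈Y only {w} e with w ∈? Y
  ... | yes w∈Y = w∈Y
  ... | no w∉Y with only w e w∉Y
  ...   | refl = ¬CanForce⇒target∈ ¬can v∈Y e (λ _ → only)

  others-filled⇒only : ∀ {Y v u} → (∀ {w} → E v w → w ≢ u → w ∈ Y) →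
                       ∀ w → E v w → w ∉ Y → w ≡ u
  others-filled⇒only {u = u} others w e w∉Y with w ≟ u
  ... | yes w≡u = w≡u
  ... | no w≢u = contradiction (others e w≢u) w∉Y

  two-unfilled⇒¬CanForce : ∀ {Y v a b u} → E v a → E v b → a ∉ Y → b ∉ Y → a ≢ b →
                           ¬ CanForce G Y v u
  two-unfilled⇒¬CanForce ea eb a∉Y b∉Y a≢b (_ , _ , _ , only) =
    a≢b (trans (only _ ea a∉Y) (sym (only _ eb b∉Y)))

  after-⊇ : ∀ X F → X ⊆ after G X F
  after-⊇ X [] x∈X = x∈X
  after-⊇ X ((v , u) ∷ F) x∈X = after-⊇ (X ∪ ⁅ u ⁆) F (x∈p⇒x∈p∪⁅y⁆ x∈X)

  after⁻ : ∀ X F {x} → x ∈ after G X F → x ∈ X ⊎ ∃ λ v → (v , x) ∈ˡ F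
  after⁻ X [] x∈ = inj₁ x∈
  after⁻ X ((v , u) ∷ F) x∈ with after⁻ (X ∪ ⁅ u ⁆) F x∈
  ... | inj₂ (w , m) = inj₂ (w , there m)
  ... | inj₁ x∈X∪u with x∈p∪⁅y⁆⁻ x∈X∪u
  ...   | inj₁ x∈X = inj₁ x∈X
  ...   | inj₂ refl = inj₂ (v , here refl)

  unforced∈after⇒∈ : ∀ {X F x} → (∀ w → (w , x) ∉ˡ F) → x ∈ after G X F → x ∈ X
  unforced∈after⇒∈ {X} {F} unforced x∈ with after⁻ X F x∈
  ... | inj₁ x∈X = x∈X
  ... | inj₂ (w , m) = contradiction m (unforced w)

  force-target : ∀ {X F v u} → ValidForces G X F → (v , u) ∈ˡ F → u ∉ X × E v u
  force-target ((_ , u∉X , e , _) ∷ _) (here refl) = u∉X , e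
  force-target (_ ∷ vf) (there m) with force-target vf m
  ... | u∉X∪ , e = u∉X∪ ∘ x∈p⇒x∈p∪⁅y⁆ , e

  forcer-nbhd-filled : ∀ {X F v u w} → ValidForces G X F → (v , u) ∈ˡ F → E v w →
                       w ∈ after G X F
  forcer-nbhd-filled {X} {(_ , u) ∷ F} {w = w} ((_ , _ , _ , only) ∷ _) (here refl) e
    with w ∈? X
  ... | yes w∈X = after-⊇ _ F (x∈p⇒x∈p∪⁅y⁆ w∈X)
  ... | no w∉X rewrite only w e w∉X = after-⊇ _ F y∈p∪⁅y⁆
  forcer-nbhd-filled (_ ∷ vf) (there m) e = forcer-nbhd-filled vf m e

  -- A force of F that is not available in Y has its target already in Y.
  after-⊆ : ∀ {X F Y} → ValidForces G X F → X ⊆ Y →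
            (∀ {v u} → (v , u) ∈ˡ F → ¬ CanForce G Y v u) → after G X F ⊆ Y
  after-⊆ [] X⊆Y _ = X⊆Y
  after-⊆ {F = (_ , u) ∷ _} {Y} ((v∈X , _ , e , only) ∷ vf) X⊆Y blocked =
    after-⊆ vf (p⊆q∧x∈q⇒p∪⁅x⁆⊆q X⊆Y u∈Y) (blocked ∘ there)
    where
    u∈Y : u ∈ Y
    u∈Y = ¬CanForce⇒target∈ (blocked (here refl)) (X⊆Y v∈X) e
            (λ _ w e′ w∉Y → only w e′ (w∉Y ∘ X⊆Y))

  forcer∈⁻ : ∀ {v} F → v ∈ˡ forcers G F → ∃ λ u → (v , u) ∈ˡ F
  forcer∈⁻ F m with ∈-map⁻ proj₁ m
  ... | (_ , u) , m′ , refl = u , m′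

  valid⇒unique-forcers : ∀ {X F} → ValidForces G X F → Unique (forcers G F)
  valid⇒unique-forcers [] = []
  valid⇒unique-forcers {X} {(v , u) ∷ F} ((_ , _ , _ , only) ∷ vf) =
    All.tabulate forces-once ∷ valid⇒unique-forcers vf
    where
    forces-once : ∀ {x} → x ∈ˡ forcers G F → v ≢ x
    forces-once m refl with forcer∈⁻ F m
    ... | u′ , m′ with force-target vf m′
    ...   | u′∉ , e with only u′ e (u′∉ ∘ x∈p⇒x∈p∪⁅y⁆)
    ...     | refl = u′∉ y∈p∪⁅y⁆

  -- Fuel: every force fills a new vertex, so at most n ∸ ∣ X ∣ forces occur.
  stalled-extension : ∀ k X → n ≤ ∣ X ∣ + k → ∃ λ F → ValidForces G X F × Stalled (after G X F)
  stalled-extension k X n≤ with any? (λ v → any? (λ u → CanForce? X v u))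
  ... | no ¬force = [] , [] , λ v u can → ¬force (v , u , can)
  stalled-extension zero X n≤ | yes (_ , _ , (_ , u∉X , _)) =
    contradiction (subst (n ≤_) (+-identityʳ ∣ X ∣) n≤) (<⇒≱ (x∉p⇒∣p∣<n u∉X))
  stalled-extension (suc k) X n≤ | yes (v , u , can@(_ , u∉X , _))
    with stalled-extension k (X ∪ ⁅ u ⁆)
           (≤-trans n≤ (subst (_≤ ∣ X ∪ ⁅ u ⁆ ∣ + k) (sym (+-suc ∣ X ∣ k))
                          (+-monoˡ-≤ k (∣p∣<∣p∪⁅x⁆∣ u∉X))))
  ... | F , vf , stalled = (v , u) ∷ F , can ∷ vf , stalled

  spans⇒isZeroForcingSet : ∀ {S} → Spans S → IsZeroForcingSet G S
  spans⇒isZeroForcingSet {S} spans with stalled-extension n S (m≤n+m n ∣ S ∣)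
  ... | F , vf , stalled = F , (vf , valid⇒unique-forcers vf) , spans _ (after-⊇ S F) stalled

  isZeroForcingSet⇒spans : ∀ {S} → IsZeroForcingSet G S → Spans S
  isZeroForcingSet⇒spans (F , (vf , _) , full) Y S⊆Y stalled x =
    after-⊆ vf S⊆Y (λ {v} {u} _ → stalled v u) (full x)

  maximal⇒stalled : ∀ {S F} → IsForcingSequence G S F → IsMaximal G S F → Stalled (after G S F)
  maximal⇒stalled {S} {F} (vf , _) maximal v u can with v ∈ˡ? forcers G F
  ... | no v-idle = maximal v u v-idle can
  ... | yes v-forces with forcer∈⁻ F v-forces
  ...   | _ , m = proj₁ (proj₂ can) (forcer-nbhd-filled vf m (proj₁ (proj₂ (proj₂ can))))

  maximal⇒full : ∀ {S F} → IsZeroForcingSet G S → IsForcingSequence G S F → IsMaximal G S F →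
                 ∀ x → x ∈ after G S F
  maximal⇒full {S} {F} zfs fs maximal =
    isZeroForcingSet⇒spans zfs _ (after-⊇ S F) (maximal⇒stalled fs maximal)

  idle⇒spansWithout : ∀ {S F z} → ValidForces G S F → (∀ w → (z , w) ∉ˡ F) →
                      (∀ x → x ∈ after G S F) → SpansWithout z S
  idle⇒spansWithout vf z-idle full Y S⊆Y stalled x =
    after-⊆ vf S⊆Y (λ {v} {u} m → stalled v u (λ { refl → z-idle u m })) (full x)

  -- When p forces z, every other neighbour of p is filled, so z cannot later force one of them.
  simplicial-not-interior : ∀ {X F p z q} → ValidForces G X F →
    (∀ {a b} → E z a → E z b → a ≢ b → E a b) → (p , z) ∈ˡ F → (z , q) ∈ˡ F → ⊥
  simplicial-not-interior ((p∈X , z∉X , _) ∷ _) _ (here refl) (here refl) = z∉X p∈X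
  simplicial-not-interior {X} {p = p} {z} {q} ((p∈X , _ , e , only) ∷ vf) simplicial
                          (here refl) (there m) with force-target vf m
  ... | q∉ , e′ = q∉ (subst (_∈ X ∪ ⁅ z ⁆) (sym q≡z) y∈p∪⁅y⁆)
    where
    p≢q : p ≢ q
    p≢q refl = q∉ (x∈p⇒x∈p∪⁅y⁆ p∈X)
    q≡z : q ≡ z
    q≡z = only q (simplicial (E-sym e) e′ p≢q) (q∉ ∘ x∈p⇒x∈p∪⁅y⁆)
  simplicial-not-interior ((z∈X , _) ∷ vf) _ (there m) (here refl) =
    proj₁ (force-target vf m) (x∈p⇒x∈p∪⁅y⁆ z∈X)
  simplicial-not-interior (_ ∷ vf) simplicial (there m) (there m′) =
    simplicial-not-interior vf simplicial m m′

  linked-pred : ∀ {R : Fin n → Fin n → Set} {x xs y} → Linked R (x ∷ xs) → y ∈ˡ xs →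
                ∃ λ p → R p y
  linked-pred {x = x} (r ∷ _) (here refl) = x , r
  linked-pred (_ ∷ l) (there m) = linked-pred l m

  linked-succ : ∀ {R : Fin n → Fin n → Set} {x xs y} → Linked R (x ∷ xs) → y ∈ˡ x ∷ xs →
                y ≢ lastOf G x xs → ∃ λ q → R y q
  linked-succ {xs = []} _ (here refl) y≢last = contradiction refl y≢last
  linked-succ {xs = x′ ∷ _} (r ∷ _) (here refl) _ = x′ , r
  linked-succ {xs = _ ∷ _} (_ ∷ l) (there m) y≢last = linked-succ l m y≢last

  isolated⇒spansWithout : ∀ {S F z} → IsOptimalForcingSequence G S F →
    (∀ w → (w , z) ∉ˡ F) → (∀ w → (z , w) ∉ˡ F) → z ∈ S × SpansWithout z S
  isolated⇒spansWithout {S} {F} {z} ((zfs , _) , fs@(vf , _) , maximal) unforced idle =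
    unforced∈after⇒∈ unforced (full z) , idle⇒spansWithout vf idle full
    where
    full : ∀ x → x ∈ after G S F
    full = maximal⇒full zfs fs maximal

  uncritical-criterion : ∀ z → (∀ {a b} → E z a → E z b → a ≢ b → E a b) →
    (∀ {S} → z ∈ S → SpansWithout z S → ∃ λ S′ → ∣ S′ ∣ < ∣ S ∣ × Spans S′) →
    IsUncritical G z
  uncritical-criterion _ _ _ _ _ _ _ [] _ (there ())
  uncritical-criterion z _ shrink S F opt@((_ , minimal) , _) _ [] (_ , unforced , idle)
                       (here refl) with isolated⇒spansWithout opt unforced idle
  ... | z∈S , spans with shrink z∈S spans
  ...   | S′ , smaller , spans′ =
    ⊥-elim (<⇒≱ smaller (minimal S′ (spans⇒isZeroForcingSet spans′)))
  uncritical-criterion z simplicial _ S F (_ , (vf , _) , _) v₀ vs@(_ ∷ _) (linked , _ , _)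
                       z∈chain =
    s≤s z≤n , position
    where
    position : z ≡ v₀ ⊎ z ≡ lastOf G v₀ vs
    position with z ≟ v₀ | z ≟ lastOf G v₀ vs
    ... | yes z≡v₀ | _ = inj₁ z≡v₀
    ... | no _ | yes z≡last = inj₂ z≡last
    ... | no z≢v₀ | no z≢last =
      ⊥-elim (simplicial-not-interior vf simplicial
                (proj₂ (linked-pred linked (tail z≢v₀ z∈chain)))
                (proj₂ (linked-succ linked z∈chain z≢last)))

module Degree {n : ℕ} (G : SimpleGraph n) where

  open Forcing G using (E; E⇒≢)

  ∈nbhd⁺ : ∀ {v w} → E v w → w ∈ nbhd G v
  ∈nbhd⁺ {v} {w} e =
    lookup⇒[]= w (tabulate (adj G v)) (trans (lookup∘tabulate (adj G v) w) e)

  ∈nbhd⁻ : ∀ {v w} → w ∈ nbhd G v → E v w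
  ∈nbhd⁻ {v} {w} w∈ = trans (sym (lookup∘tabulate (adj G v) w)) ([]=⇒lookup w∈)

  deg≥1⇒neighbour : ∀ {v} → 1 ≤ deg G v → ∃ λ w → E v w
  deg≥1⇒neighbour {v} 1≤deg with nonempty? (nbhd G v)
  ... | yes (w , w∈) = w , ∈nbhd⁻ w∈
  ... | no empty with subst (1 ≤_) (trans (cong ∣_∣ (Empty-unique empty)) (∣⊥∣≡0 n)) 1≤deg
  ...   | ()

  module _ {T : Subset n} (T-clique : IsClique G T) {v : Fin n} (v∈T : v ∈ T) where

    clique⊆closedNbhd : T ⊆ nbhd G v ∪ ⁅ v ⁆
    clique⊆closedNbhd {x} x∈T with x ≟ v
    ... | yes refl = y∈p∪⁅y⁆
    ... | no x≢v = x∈p⇒x∈p∪⁅y⁆ (∈nbhd⁺ (T-clique v x v∈T x∈T (≢-sym x≢v)))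

    ∣clique∣≤1+deg : ∣ T ∣ ≤ suc (deg G v)
    ∣clique∣≤1+deg = ≤-trans (p⊆q⇒∣p∣≤∣q∣ clique⊆closedNbhd) (∣p∪⁅x⁆∣≤1+∣p∣ (nbhd G v) v)

    1+deg≡∣clique∣⇒nbhd⊆clique : suc (deg G v) ≡ ∣ T ∣ → ∀ {w} → E v w → w ∈ T
    1+deg≡∣clique∣⇒nbhd⊆clique 1+deg≡∣T∣ {w} e with w ∈? T
    ... | yes w∈T = w∈T
    ... | no w∉T = contradiction ∣T∣<∣T∣ (<-irrefl refl)
      where
      ∣T∣<∣T∣ : ∣ T ∣ < ∣ T ∣
      ∣T∣<∣T∣ = ≤-trans (p⊂q⇒∣p∣<∣q∣ (clique⊆closedNbhd , w , x∈p⇒x∈p∪⁅y⁆ (∈nbhd⁺ e) , w∉T))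
                        (subst (_ ≤_) 1+deg≡∣T∣ (∣p∪⁅x⁆∣≤1+∣p∣ (nbhd G v) v))

    clique-exit : suc (deg G v) ≢ ∣ T ∣ → ∃ λ b → E v b × b ∉ T
    clique-exit 1+deg≢∣T∣ with any? (λ b → (adj G v b Bool.≟ true) ×-dec ¬? (b ∈? T))
    ... | yes exit = exit
    ... | no no-exit = contradiction (≤-antisym 1+deg≤∣T∣ ∣clique∣≤1+deg) 1+deg≢∣T∣
      where
      nbhd⊆T-v : nbhd G v ⊆ T - v
      nbhd⊆T-v {w} w∈ with w ∈? T
      ... | yes w∈T = x∈p∧x≢y⇒x∈p-y w∈T (≢-sym (E⇒≢ (∈nbhd⁻ w∈)))
      ... | no w∉T = contradiction (w , ∈nbhd⁻ w∈ , w∉T) no-exit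
      1+deg≤∣T∣ : suc (deg G v) ≤ ∣ T ∣
      1+deg≤∣T∣ = ≤-trans (s≤s (p⊆q⇒∣p∣≤∣q∣ nbhd⊆T-v)) (x∈p⇒∣p-x∣<∣p∣ v∈T)

module Configuration {n : ℕ} (G : SimpleGraph n) (T : Subset n) (z : Fin n)
  (z∈T : z ∈ T) (T-clique : IsClique G T) (∁T-clique : IsClique G (∁ T))
  (nbhd-z⊆T : ∀ {w} → Forcing.E G z w → w ∈ T)
  (exit : ∀ {a} → a ∈ T → a ≢ z → ∃ λ b → Forcing.E G a b × b ∉ T)
  (a₀ : Fin n) (z~a₀ : Forcing.E G z a₀) where

  open Forcing G

  T∖z : Fin n → Set
  T∖z a = a ∈ T × a ≢ z

  MissesAtMostOne : Subset n → Set
  MissesAtMostOne Y = ∀ {a b} → T∖z a → T∖z b → a ∉ Y → b ∉ Y → a ≡ b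

  adjacent-in-T : ∀ {u v} → u ∈ T → v ∈ T → u ≢ v → E u v
  adjacent-in-T = T-clique _ _

  adjacent-in-∁T : ∀ {u v} → u ∉ T → v ∉ T → u ≢ v → E u v
  adjacent-in-∁T u∉T v∉T = ∁T-clique _ _ (x∉p⇒x∈∁p u∉T) (x∉p⇒x∈∁p v∉T)

  nbhd-z⊆T∖z : ∀ {w} → E z w → T∖z w
  nbhd-z⊆T∖z e = nbhd-z⊆T e , ≢-sym (E⇒≢ e)

  a₀∈T : a₀ ∈ T
  a₀∈T = proj₁ (nbhd-z⊆T∖z z~a₀)

  a₀≢z : a₀ ≢ z
  a₀≢z = proj₂ (nbhd-z⊆T∖z z~a₀)

  ∁T-¬E-z : ∀ {b} → b ∉ T → ¬ E b z
  ∁T-¬E-z b∉T e = b∉T (nbhd-z⊆T (E-sym e))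

  ∁T-vertex≢z : ∀ {b} → b ∉ T → b ≢ z
  ∁T-vertex≢z b∉T refl = b∉T z∈T

  ∁T⊆stalled : ∀ {Y v u} → Stalled Y → v ∈ Y → v ∉ T → (∀ w → E v w → w ∉ Y → w ≡ u) →
               ∀ {b} → b ∉ T → b ∈ Y
  ∁T⊆stalled {v = v} stalled v∈Y v∉T only {b} b∉T with b ≟ v
  ... | yes refl = v∈Y
  ... | no b≢v = ¬CanForce⇒nbhd⊆ (stalled _ _) v∈Y only (adjacent-in-∁T v∉T b∉T (≢-sym b≢v))

  module _ {Y : Subset n} (stalled : Stalled Y) (∁T⊆Y : ∀ {b} → b ∉ T → b ∈ Y)
           (misses≤1 : MissesAtMostOne Y) where

    ∉⇒∈T : ∀ {w} → w ∉ Y → w ∈ T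
    ∉⇒∈T {w} w∉Y with w ∈? T
    ... | yes w∈T = w∈T
    ... | no w∉T = contradiction (∁T⊆Y w∉T) w∉Y

    -- An unfilled a ∈ T ∖ z would be the only unfilled neighbour of its exit, which lies in Y.
    T∖z⊆Y : ∀ {a} → T∖z a → a ∈ Y
    T∖z⊆Y {a} a∈T∖z@(a∈T , a≢z) with exit a∈T a≢z
    ... | b , e , b∉T = ¬CanForce⇒target∈ (stalled b a) (∁T⊆Y b∉T) (E-sym e) only
      where
      only : a ∉ Y → ∀ w → E b w → w ∉ Y → w ≡ a
      only a∉Y w e′ w∉Y = misses≤1 (∉⇒∈T w∉Y , λ { refl → ∁T-¬E-z b∉T e′ }) a∈T∖z w∉Y a∉Y

    all-but-z∈Y : ∀ {w} → w ≢ z → w ∈ Y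
    all-but-z∈Y {w} w≢z with w ∈? T
    ... | yes w∈T = T∖z⊆Y (w∈T , w≢z)
    ... | no w∉T = ∁T⊆Y w∉T

    stalled⇒full : ∀ x → x ∈ Y
    stalled⇒full x with x ≟ z
    ... | no x≢z = all-but-z∈Y x≢z
    ... | yes refl = ¬CanForce⇒target∈ (stalled a₀ z) (all-but-z∈Y a₀≢z)
                       (adjacent-in-T a₀∈T z∈T a₀≢z) (λ _ → others-filled⇒only (λ _ → all-but-z∈Y))

  module _ {S : Subset n} (z∈S : z ∈ S) (spans : SpansWithout z S) where

    -- Two unfilled vertices of T ∖ z block every forcer in T, while z is invisible to forcers
    -- outside T; so adding z to Y would give a set that spans without z but misses them.
    misses≤1 : ∀ {Y} → S - z ⊆ Y → Stalled Y → MissesAtMostOne Y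
    misses≤1 {Y} S-z⊆Y stalled {a} {b} a∈T∖z b∈T∖z a∉Y b∉Y with a ≟ b
    ... | yes a≡b = a≡b
    ... | no a≢b =
      contradiction (spans (Y ∪ ⁅ z ⁆) (p-x⊆q⇒p⊆q∪⁅x⁆ S-z⊆Y) stalledExcept a) (∉Y∪z a∈T∖z a∉Y)
      where
      ∉Y∪z : ∀ {c} → T∖z c → c ∉ Y → c ∉ Y ∪ ⁅ z ⁆
      ∉Y∪z (_ , c≢z) c∉Y = [ c∉Y , c≢z ] ∘ x∈p∪⁅y⁆⁻
      stalledExcept : StalledExcept z (Y ∪ ⁅ z ⁆)
      stalledExcept v w v≢z can@(v∈ , w∉ , e , only) with x∈p∪⁅y⁆⁻ v∈
      ... | inj₂ v≡z = v≢z v≡z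
      ... | inj₁ v∈Y with v ∈? T
      ...   | yes v∈T = two-unfilled⇒¬CanForce (adjacent v∈T a∈T∖z a∉Y) (adjacent v∈T b∈T∖z b∉Y)
                          (∉Y∪z a∈T∖z a∉Y) (∉Y∪z b∈T∖z b∉Y) a≢b can
        where
        adjacent : ∀ {c} → v ∈ T → T∖z c → c ∉ Y → E v c
        adjacent v∈T (c∈T , _) c∉Y = adjacent-in-T v∈T c∈T λ { refl → c∉Y v∈Y }
      ...   | no v∉T = stalled v w (v∈Y , w∉ ∘ x∈p⇒x∈p∪⁅y⁆ , e , only′)
        where
        only′ : ∀ w′ → E v w′ → w′ ∉ Y → w′ ≡ w
        only′ w′ e′ w′∉Y = only w′ e′ ([ w′∉Y , (λ { refl → ∁T-¬E-z v∉T e′ }) ] ∘ x∈p∪⁅y⁆⁻)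

    spans-S-a₀ : (∀ {a} → T∖z a → a ∈ S) → Spans (S - a₀)
    spans-S-a₀ T∖z⊆S Y S-a₀⊆Y stalled =
      spans Y (p-x⊆q∧x∈q⇒p⊆q S-a₀⊆Y a₀∈Y) (λ v u _ → stalled v u)
      where
      a₀∈Y : a₀ ∈ Y
      a₀∈Y = ¬CanForce⇒target∈ (stalled z a₀) (S-a₀⊆Y (x∈p∧x≢y⇒x∈p-y z∈S (≢-sym a₀≢z)))
               (adjacent-in-T z∈T a₀∈T (≢-sym a₀≢z))
               (λ _ → others-filled⇒only λ e w≢a₀ →
                        S-a₀⊆Y (x∈p∧x≢y⇒x∈p-y (T∖z⊆S (nbhd-z⊆T∖z e)) w≢a₀))

    spans-S-z : ∀ {v u} → v ∉ T → CanForce G S v u → Spans (S - z)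
    spans-S-z {v} {u} v∉T (v∈S , _ , _ , only) Y S-z⊆Y stalled =
      stalled⇒full stalled (∁T⊆stalled stalled v∈Y v∉T only′) (misses≤1 S-z⊆Y stalled)
      where
      v∈Y : v ∈ Y
      v∈Y = S-z⊆Y (x∈p∧x≢y⇒x∈p-y v∈S (∁T-vertex≢z v∉T))
      only′ : ∀ w → E v w → w ∉ Y → w ≡ u
      only′ w e w∉Y =
        only w e λ w∈S → w∉Y (S-z⊆Y (x∈p∧x≢y⇒x∈p-y w∈S λ { refl → ∁T-¬E-z v∉T e }))

    module _ {v u a b} (v∈T : v ∈ T) (can : CanForce G S v u) (a∈T : a ∈ T) (a∉S : a ∉ S)
             (e : E v b) (b∉T : b ∉ T) where

      v∈S : v ∈ S
      v∈S = proj₁ can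

      u∉S : u ∉ S
      u∉S = proj₁ (proj₂ can)

      only : ∀ w → E v w → w ∉ S → w ≡ u
      only = proj₂ (proj₂ (proj₂ can))

      T∖S-forced : ∀ {w} → w ∈ T → w ∉ S → w ≡ u
      T∖S-forced w∈T w∉S = only _ (adjacent-in-T v∈T w∈T λ { refl → w∉S v∈S }) w∉S

      u∈T : u ∈ T
      u∈T = subst (_∈ T) (T∖S-forced a∈T a∉S) a∈T

      exit∈S : b ∈ S
      exit∈S with b ∈? S
      ... | yes b∈S = b∈S
      ... | no b∉S = contradiction (subst (_∈ T) (sym (only b e b∉S)) u∈T) b∉T

      spans-S-b : Spans (S - b)
      spans-S-b Y S-b⊆Y stalled = spans Y (p-x⊆q∧x∈q⇒p⊆q S-b⊆Y b∈Y) (λ v u _ → stalled v u)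
        where
        S∖b⊆Y : ∀ {w} → w ∈ S → w ≢ b → w ∈ Y
        S∖b⊆Y w∈S w≢b = S-b⊆Y (x∈p∧x≢y⇒x∈p-y w∈S w≢b)
        T∩S⊆Y : ∀ {w} → w ∈ T → w ∈ S → w ∈ Y
        T∩S⊆Y w∈T w∈S = S∖b⊆Y w∈S λ { refl → b∉T w∈T }
        u∈Y : u ∈ Y
        u∈Y = ¬CanForce⇒target∈ (stalled z u) (T∩S⊆Y z∈T z∈S)
                (adjacent-in-T z∈T u∈T λ { refl → u∉S z∈S })
                (λ _ → others-filled⇒only λ {w} e′ w≢u →
                         T∩S⊆Y (nbhd-z⊆T e′) (T∖u⊆S w (nbhd-z⊆T e′) w≢u))
          where
          T∖u⊆S : ∀ w → w ∈ T → w ≢ u → w ∈ S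
          T∖u⊆S w w∈T w≢u with w ∈? S
          ... | yes w∈S = w∈S
          ... | no w∉S = contradiction (T∖S-forced w∈T w∉S) w≢u
        b∈Y : b ∈ Y
        b∈Y = ¬CanForce⇒target∈ (stalled v b) (T∩S⊆Y v∈T v∈S) e
                (λ _ → others-filled⇒only λ {w} e′ w≢b → nbhd-v∖b⊆Y w e′ w≢b)
          where
          nbhd-v∖b⊆Y : ∀ w → E v w → w ≢ b → w ∈ Y
          nbhd-v∖b⊆Y w e′ w≢b with w ∈? S
          ... | yes w∈S = S∖b⊆Y w∈S w≢b
          ... | no w∉S = subst (_∈ Y) (sym (only w e′ w∉S)) u∈Y

    smaller-spanning-set : ∃ λ S′ → ∣ S′ ∣ < ∣ S ∣ × Spans S′
    smaller-spanning-set with any? (λ a → (a ∈? T) ×-dec ¬? (a ≟ z) ×-dec ¬? (a ∈? S))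
    ... | no T∖z⊈S = S - a₀ , x∈p⇒∣p-x∣<∣p∣ (T∖z⊆S (a₀∈T , a₀≢z)) , spans-S-a₀ T∖z⊆S
      where
      T∖z⊆S : ∀ {a} → T∖z a → a ∈ S
      T∖z⊆S {a} (a∈T , a≢z) with a ∈? S
      ... | yes a∈S = a∈S
      ... | no a∉S = contradiction (a , a∈T , a≢z , a∉S) T∖z⊈S
    ... | yes (u , u∈T , _ , u∉S) with force-or-stalledExcept z S
    ...   | inj₂ stalledExcept = contradiction (spans S (λ x∈S → x∈S) stalledExcept u) u∉S
    ...   | inj₁ (v , w , v≢z , can) with v ∈? T
    ...     | no v∉T = S - z , x∈p⇒∣p-x∣<∣p∣ z∈S , spans-S-z v∉T can
    ...     | yes v∈T with exit v∈T v≢z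
    ...       | b , e , b∉T =
      S - b , x∈p⇒∣p-x∣<∣p∣ (exit∈S v∈T can u∈T u∉S e b∉T) , spans-S-b v∈T can u∈T u∉S e b∉T

proposition5p7 : ∀ (n : ℕ) (G : SimpleGraph n) (T : Subset n) (z : Fin n) →
    IsClique G T → z ∈ T →
    deg G z ≡ ∣ T ∣ ∸ 1 → 1 ≤ ∣ T ∣ ∸ 1 →
    (∀ w → w ∈ T → deg G w ≡ ∣ T ∣ ∸ 1 → w ≡ z) →
    IsClique G (∁ T) →
    IsUncritical G z
proposition5p7 n G T z T-clique z∈T deg-z 1≤deg-z deg-unique ∁T-clique =
  uncritical-criterion z simplicial smaller-spanning-set
  where
  open Forcing G
  open Degree G
  1+deg-z≡∣T∣ : suc (deg G z) ≡ ∣ T ∣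
  1+deg-z≡∣T∣ =
    trans (cong suc deg-z) (trans (+-comm 1 _) (m∸n+n≡m (≤-trans 1≤deg-z (m∸n≤m _ 1))))
  nbhd-z⊆T : ∀ {w} → E z w → w ∈ T
  nbhd-z⊆T = 1+deg≡∣clique∣⇒nbhd⊆clique T-clique z∈T 1+deg-z≡∣T∣
  simplicial : ∀ {a b} → E z a → E z b → a ≢ b → E a b
  simplicial e e′ = T-clique _ _ (nbhd-z⊆T e) (nbhd-z⊆T e′)
  exit : ∀ {a} → a ∈ T → a ≢ z → ∃ λ b → E a b × b ∉ T
  exit a∈T a≢z =
    clique-exit T-clique a∈T λ 1+deg≡∣T∣ → a≢z (deg-unique _ a∈T (cong (_∸ 1) 1+deg≡∣T∣))
  z-neighbour : ∃ λ a → E z a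
  z-neighbour = deg≥1⇒neighbour (subst (1 ≤_) (sym deg-z) 1≤deg-z)
  open Configuration G T z z∈T T-clique ∁T-clique nbhd-z⊆T exit
         (proj₁ z-neighbour) (proj₂ z-neighbour)
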